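{- Let $G$ be a cubic brick, let $u_1u_2u_3$ be a triangle of $G$, and let $v_1$ be the neighbour of $u_1$ outside the triangle, so that $u_1v_1\in E(G)$. Let $G'$ be the graph obtained from $G$ by contracting $\{u_1,u_2,u_3\}$ to a single vertex $u$. If the edge $uv_1$ is removable in $G'$, then $u_2u_3$ is removable in $G$.
   Context: All graphs are finite, simple and undirected. A connected graph is matching covered if every edge lies in some perfect matching; an edge $e$ of a matching covered graph $G$ is removable if $G-e$ is matching covered. A brick is a 3-connected graph $G$ such that $G-\{x,y\}$ has a perfect matching for any two distinct vertices $x,y$. Contracting a vertex set $X$ to a vertex $u$ means deleting $X$, adding a new vertex $u$, and joining $u$ to the endpoint outside $X$ of each edge with exactly one end in $X$ (edge $u_1v_1$ becomes $uv_1$). -}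

module Defs where

open import Data.Nat using (ℕ; _≤_)
open import Data.Fin using (Fin; _≟_)
open import Data.Bool using (Bool; true; false; T; not; _∨_; if_then_else_)
open import Data.List using (List; map; allFin; length)
open import Data.Nat.ListAction using (sum)
open import Data.List.Membership.Propositional using (_∉_)
open import Data.Maybe using (Maybe; just; nothing)
open import Data.Product using (Σ; _×_; _,_)
open import Data.Sum using (_⊎_)
open import Data.Unit using (⊤)
open import Data.Empty using (⊥)
open import Relation.Nullary using (¬_; yes; no)
open import Relation.Nullary.Decidable using (⌊_⌋)
open import Relation.Binary.PropositionalEquality using (_≡_; _≢_; refl)

data Walk {V : Set} (R : V → V → Set) (S : V → Set) : V → V → Set where
  stop : ∀ {x} → S x → Walk R S x x
  step : ∀ {x y z} → S x → R x y → Walk R S y z → Walk R S x z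

ConnectedOn : {V : Set} → (V → V → Set) → (V → Set) → Set
ConnectedOn {V} R S = ∀ (x y : V) → S x → S y → Walk R S x y

Connected : {V : Set} → (V → V → Set) → Set
Connected R = ConnectedOn R (λ _ → ⊤)

PerfectMatchingOn : {V : Set} → (V → V → Set) → (V → Set) → (V → V) → Set
PerfectMatchingOn {V} R S m = ∀ (v : V) → S v → S (m v) × R v (m v) × m (m v) ≡ v

PerfectMatching : {V : Set} → (V → V → Set) → (V → V) → Set
PerfectMatching R m = PerfectMatchingOn R (λ _ → ⊤) m

MatchingCovered : {V : Set} → (V → V → Set) → Set
MatchingCovered {V} R =
  Connected R × (∀ (x y : V) → R x y → Σ (V → V) λ m → PerfectMatching R m × m x ≡ y)

DeleteEdge : {V : Set} → (V → V → Set) → V → V → V → V → Set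
DeleteEdge R a b x y = R x y × ¬ (x ≡ a × y ≡ b) × ¬ (x ≡ b × y ≡ a)

Removable : {V : Set} → (V → V → Set) → V → V → Set
Removable R a b = MatchingCovered R × R a b × MatchingCovered (DeleteEdge R a b)

record SimpleGraph (n : ℕ) : Set where
  field
    adj        : Fin n → Fin n → Bool
    adj-sym    : ∀ x y → adj x y ≡ adj y x
    adj-irrefl : ∀ x → adj x x ≡ false

  Adj : Fin n → Fin n → Set
  Adj x y = T (adj x y)

  degree : Fin n → ℕ
  degree v = sum (map (λ w → if adj v w then 1 else 0) (allFin n))

module _ {n : ℕ} (G : SimpleGraph n) where
  open SimpleGraph G

  Cubic : Set
  Cubic = ∀ v → degree v ≡ 3

  ThreeConnected : Set
  ThreeConnected =
    4 ≤ n × (∀ (X : List (Fin n)) → length X ≤ 2 → ConnectedOn Adj (λ v → v ∉ X))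

  Brick : Set
  Brick = ThreeConnected ×
    (∀ (x y : Fin n) → x ≢ y →
       Σ (Fin n → Fin n) λ m → PerfectMatchingOn Adj (λ v → v ≢ x × v ≢ y) m)

  Triangle : Fin n → Fin n → Fin n → Set
  Triangle a b c = Adj a b × Adj b c × Adj a c

  adj⇒≢ : ∀ {x y} → Adj x y → x ≢ y
  adj⇒≢ {x} a refl with adj x x | adj-irrefl x
  adj⇒≢ {x} () refl | .false | refl

  -- Contraction of X = {u₁,u₂,u₃} to a single new vertex u (= nothing).
  module Contraction (u₁ u₂ u₃ : Fin n) where

    outside : Fin n → Bool
    outside v = not (⌊ v ≟ u₁ ⌋ ∨ ⌊ v ≟ u₂ ⌋ ∨ ⌊ v ≟ u₃ ⌋)

    InX : Fin n → Set
    InX x = x ≡ u₁ ⊎ x ≡ u₂ ⊎ x ≡ u₃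

    CV : Set
    CV = Maybe (Σ (Fin n) λ v → T (outside v))

    CAdj : CV → CV → Set
    CAdj nothing nothing = ⊥
    CAdj nothing (just (y , _)) = Σ (Fin n) λ x → InX x × Adj x y
    CAdj (just (x , _)) nothing = Σ (Fin n) λ y → InX y × Adj x y
    CAdj (just (x , _)) (just (y , _)) = Adj x y

    outside-intro : ∀ v → v ≢ u₁ → v ≢ u₂ → v ≢ u₃ → T (outside v)
    outside-intro v p q r with v ≟ u₁ | v ≟ u₂ | v ≟ u₃
    ... | yes e | _ | _ = p e
    ... | no _ | yes e | _ = q e
    ... | no _ | no _ | yes e = r e
    ... | no _ | no _ | no _ = _

    old : (v : Fin n) → v ≢ u₁ → v ≢ u₂ → v ≢ u₃ → CV
    old v p q r = just (v , outside-intro v p q r)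

{-# OPTIONS --safe #-}
-- Let w₂, w₃ be the neighbours of u₂, u₃ outside the triangle. As a brick, G is matching covered
-- and G − u₂u₃ is connected, so it suffices to put every edge xy ≠ u₂u₃ into a perfect matching
-- of G avoiding u₂u₃. At u₂ or u₃ any perfect matching through xy will do. An edge outside the
-- triangle lies in a perfect matching M of G′ − uv₁; M matches u with w₂ or w₃ (not v₁), and
-- lifts to G by matching u₂ (resp. u₃) with that vertex and the other two triangle vertices with
-- each other. For u₁v₁: if w₂ = w₃, then u has a single possible partner in G′ − uv₁, which
-- contradicts matching coveredness; so w₂ ≠ w₃, every perfect matching of G − w₂ − w₃ contains
-- u₁v₁ and u₂u₃, and trading u₂u₃ for u₂w₂, u₃w₃ gives the required matching.
module Submission where

open import Defs
open import Data.Nat using (ℕ; zero; suc; _+_; z≤n; s≤s)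
open import Data.Nat.Properties using (suc-injective)
open import Data.Fin using (Fin; zero; suc; _≟_)
open import Data.Bool using (Bool; true; false; T; if_then_else_)
open import Data.Bool.Properties using (T-irrelevant)
open import Data.List using ([]; _∷_; map; tabulate)
open import Data.List.Relation.Unary.Any using (here)
open import Data.Nat.ListAction using (sum)
open import Data.Maybe using (just; nothing)
open import Data.Product using (Σ; ∃-syntax; _×_; _,_; proj₁; proj₂)
open import Data.Sum using (_⊎_; inj₁; inj₂)
open import Data.Unit using (⊤; tt)
open import Data.Empty using (⊥; ⊥-elim)
open import Function using (_∘_; id)
open import Relation.Nullary using (¬_; yes; no; does)
open import Relation.Nullary.Decidable using (T?; _⊎-dec_)
open import Relation.Binary.PropositionalEquality

countTrue : ∀ {n} → (Fin n → Bool) → ℕ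
countTrue {zero}  f = 0
countTrue {suc n} f = (if f zero then 1 else 0) + countTrue (f ∘ suc)

remove : ∀ {n} → (Fin n → Bool) → Fin n → Fin n → Bool
remove f a w = if does (w ≟ a) then false else f w

module _ {n : ℕ} (f : Fin n → Bool) where

  T-remove⁺ : ∀ {a w} → T (f w) → w ≢ a → T (remove f a w)
  T-remove⁺ {a} {w} t w≢a with w ≟ a
  ... | yes w≡a = w≢a w≡a
  ... | no _    = t

  T-remove⁻ : ∀ {a w} → T (remove f a w) → T (f w) × w ≢ a
  T-remove⁻ {a} {w} t with w ≟ a
  ... | no w≢a = t , w≢a

sum-indicator-tabulate : ∀ {A : Set} {n} (f : A → Bool) (h : Fin n → A) →
  sum (map (λ w → if f w then 1 else 0) (tabulate h)) ≡ countTrue (f ∘ h)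
sum-indicator-tabulate {n = zero}  f h = refl
sum-indicator-tabulate {n = suc n} f h = cong (_ +_) (sum-indicator-tabulate f (h ∘ suc))

countTrue-remove : ∀ {n} (f : Fin n → Bool) {a} → T (f a) → countTrue f ≡ suc (countTrue (remove f a))
countTrue-remove {suc n} f {zero} t with f zero
... | true = refl
countTrue-remove {suc n} f {suc a} t with f zero
... | true  = cong suc (countTrue-remove (f ∘ suc) {a} t)
... | false = countTrue-remove (f ∘ suc) {a} t

countTrue-pick : ∀ {n} (f : Fin n → Bool) {k} → countTrue f ≡ suc k → ∃[ a ] T (f a)
countTrue-pick {suc n} f e with f zero in eq
... | true  = zero , subst T (sym eq) tt
... | false = let a , t = countTrue-pick (f ∘ suc) e in suc a , t

countTrue-zero : ∀ {n} (f : Fin n → Bool) {a} → countTrue f ≡ 0 → ¬ T (f a)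
countTrue-zero f e t with () ← trans (sym e) (countTrue-remove f t)

countTrue-removeOne : ∀ {n} (f : Fin n → Bool) {a k} → countTrue f ≡ suc k → T (f a) →
  countTrue (remove f a) ≡ k
countTrue-removeOne f e t = suc-injective (trans (sym (countTrue-remove f t)) e)

another-true : ∀ {n} (f : Fin n → Bool) {a k} → countTrue f ≡ suc (suc k) → T (f a) →
  ∃[ c ] T (f c) × c ≢ a
another-true f e t =
  let c , t′ = countTrue-pick (remove f _) (countTrue-removeOne f e t) in c , T-remove⁻ f t′

third-true : ∀ {n} (f : Fin n → Bool) {a b k} → countTrue f ≡ suc (suc (suc k)) →
  T (f a) → T (f b) → a ≢ b → ∃[ c ] T (f c) × c ≢ a × c ≢ b
third-true f e ta tb a≢b =
  let c , t′ , c≢b = another-true (remove f _) (countTrue-removeOne f e ta) (T-remove⁺ f tb (a≢b ∘ sym))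
      t , c≢a = T-remove⁻ f t′
  in c , t , c≢a , c≢b

only-three-true : ∀ {n} (f : Fin n → Bool) {a b c d} → countTrue f ≡ 3 →
  T (f a) → T (f b) → T (f c) → a ≢ b → a ≢ c → b ≢ c → T (f d) → d ≡ a ⊎ d ≡ b ⊎ d ≡ c
only-three-true f {a} {b} {c} {d} e ta tb tc a≢b a≢c b≢c td with d ≟ a | d ≟ b | d ≟ c
... | yes d≡a | _       | _       = inj₁ d≡a
... | no _    | yes d≡b | _       = inj₂ (inj₁ d≡b)
... | no _    | no _    | yes d≡c = inj₂ (inj₂ d≡c)
... | no d≢a  | no d≢b  | no d≢c  =
  ⊥-elim (countTrue-zero f₃ {d} count₃ (T-remove⁺ f₂ (T-remove⁺ f₁ (T-remove⁺ f td d≢a) d≢b) d≢c))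
  where
    f₁ f₂ f₃ : Fin _ → Bool
    f₁ = remove f a
    f₂ = remove f₁ b
    f₃ = remove f₂ c
    count₃ : countTrue f₃ ≡ 0
    count₃ = countTrue-removeOne f₂ (countTrue-removeOne f₁ (countTrue-removeOne f e ta)
      (T-remove⁺ f tb (a≢b ∘ sym))) (T-remove⁺ f₁ (T-remove⁺ f tc (a≢c ∘ sym)) (b≢c ∘ sym))

Walk-head : ∀ {V : Set} {R : V → V → Set} {S : V → Set} {x y} → Walk R S x y → S x
Walk-head (stop s)     = s
Walk-head (step s _ _) = s

Walk-weaken : ∀ {V : Set} {R R′ : V → V → Set} {S : V → Set} →
  (∀ {a b} → S a → S b → R a b → R′ a b) → ∀ {x y} → Walk R S x y → Walk R′ (λ _ → ⊤) x y
Walk-weaken f (stop _)     = stop tt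
Walk-weaken f (step s r w) = step tt (f s (Walk-head w) r) (Walk-weaken f w)

Walk-snoc : ∀ {V : Set} {R : V → V → Set} {x y z} →
  Walk R (λ _ → ⊤) x y → R y z → Walk R (λ _ → ⊤) x z
Walk-snoc (stop _)     r′ = step tt r′ (stop tt)
Walk-snoc (step s r w) r′ = step s r (Walk-snoc w r′)

Walk-firstStep : ∀ {V : Set} {R : V → V → Set} {S : V → Set} {x y} →
  Walk R S x y → x ≢ y → ∃[ z ] R x z
Walk-firstStep (stop _)     x≢y = ⊥-elim (x≢y refl)
Walk-firstStep (step _ r _) _   = _ , r

module _ {V : Set} {R : V → V → Set} {m : V → V} (pm : PerfectMatching R m) where

  PerfectMatching-involutive : ∀ v → m (m v) ≡ v
  PerfectMatching-involutive v = proj₂ (proj₂ (pm v tt))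

  PerfectMatching-sym : ∀ {x y} → m x ≡ y → m y ≡ x
  PerfectMatching-sym {x} refl = PerfectMatching-involutive x

  PerfectMatching-⊆ : ∀ {R′ : V → V → Set} → (∀ {x y} → R x y → R′ x y) → PerfectMatching R′ m
  PerfectMatching-⊆ R⊆R′ v _ = let _ , r , inv = pm v tt in tt , R⊆R′ r , inv

  PerfectMatching-DeleteEdge : ∀ {a b} → m a ≢ b → PerfectMatching (DeleteEdge R a b) m
  PerfectMatching-DeleteEdge {a} {b} ma≢b v _ =
    tt , (proj₁ (proj₂ (pm v tt)) , not-ab , not-ba) , PerfectMatching-involutive v
    where
      not-ab : ¬ (v ≡ a × m v ≡ b)
      not-ab (refl , mv≡b) = ma≢b mv≡b
      not-ba : ¬ (v ≡ b × m v ≡ a)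
      not-ba (refl , mv≡a) = ma≢b (PerfectMatching-sym mv≡a)

  PerfectMatching-avoids-adjacent : ∀ {a b x y} → m x ≡ y → DeleteEdge R a b x y →
    x ≡ a ⊎ x ≡ b ⊎ y ≡ a ⊎ y ≡ b → m a ≢ b
  PerfectMatching-avoids-adjacent mx≡y (_ , ¬ab , ¬ba) (inj₁ refl) ma≡b =
    ¬ab (refl , trans (sym mx≡y) ma≡b)
  PerfectMatching-avoids-adjacent mx≡y (_ , ¬ab , ¬ba) (inj₂ (inj₁ refl)) ma≡b =
    ¬ba (refl , trans (sym mx≡y) (PerfectMatching-sym ma≡b))
  PerfectMatching-avoids-adjacent mx≡y (_ , ¬ab , ¬ba) (inj₂ (inj₂ (inj₁ refl))) ma≡b =
    ¬ba (trans (sym (PerfectMatching-sym mx≡y)) ma≡b , refl)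
  PerfectMatching-avoids-adjacent mx≡y (_ , ¬ab , ¬ba) (inj₂ (inj₂ (inj₂ refl))) ma≡b =
    ¬ab (trans (sym (PerfectMatching-sym mx≡y)) (PerfectMatching-sym ma≡b) , refl)

module _ {V : Set} {R : V → V → Set} {S : V → Set} {N : V → V} (pm : PerfectMatchingOn R S N) where

  PerfectMatchingOn-involutive : ∀ {v} → S v → N (N v) ≡ v
  PerfectMatchingOn-involutive Sv = proj₂ (proj₂ (pm _ Sv))

  PerfectMatchingOn-removePair : ∀ {p q} → S p → N p ≡ q →
    PerfectMatchingOn R (λ v → S v × v ≢ p × v ≢ q) N
  PerfectMatchingOn-removePair {p} Sp refl v (Sv , v≢p , v≢Np) =
    let SNv , r , NNv = pm v Sv
    in (SNv , (λ Nv≡p → v≢Np (trans (sym NNv) (cong N Nv≡p))) ,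
              (λ Nv≡Np → v≢p (trans (sym NNv) (trans (cong N Nv≡Np) (PerfectMatchingOn-involutive Sp))))) ,
       r , NNv

  PerfectMatchingOn-stranded : ∀ {c p q} → S c → S p → N p ≡ q → c ≢ p → c ≢ q →
    (∀ {y} → R c y → S y → y ≡ p ⊎ y ≡ q) → ⊥
  PerfectMatchingOn-stranded {c} {p} Sc Sp refl c≢p c≢q nbrs with pm c Sc
  ... | SNc , rNc , NNc with nbrs rNc SNc
  ... | inj₁ Nc≡p  = c≢q (trans (sym NNc) (cong N Nc≡p))
  ... | inj₂ Nc≡Np = c≢p (trans (sym NNc) (trans (cong N Nc≡Np) (PerfectMatchingOn-involutive Sp)))

MatchingCovered⇒PerfectMatching : ∀ {V : Set} {R : V → V → Set} {x y : V} → MatchingCovered R → x ≢ y →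
  ∃[ m ] PerfectMatching R m
MatchingCovered⇒PerfectMatching {x = x} {y} (conn , covered) x≢y =
  let z , r = Walk-firstStep (conn x y tt tt) x≢y
      m , pm , _ = covered x z r
  in m , pm

module _ {n : ℕ} (G : SimpleGraph n) where
  open SimpleGraph G

  Adj-sym : ∀ {x y} → Adj x y → Adj y x
  Adj-sym {x} {y} = subst T (adj-sym x y)

  degree≡countTrue : ∀ v → degree v ≡ countTrue (adj v)
  degree≡countTrue v = sum-indicator-tabulate (adj v) id

  patch : Fin n → Fin n → (Fin n → Fin n) → Fin n → Fin n
  patch a b f v = if does (v ≟ a) then b else if does (v ≟ b) then a else f v

  patch-first : ∀ a b f → patch a b f a ≡ b
  patch-first a b f with a ≟ a
  ... | yes _   = refl
  ... | no a≢a = ⊥-elim (a≢a refl)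

  patch-second : ∀ a b f → a ≢ b → patch a b f b ≡ a
  patch-second a b f a≢b with b ≟ a | b ≟ b
  ... | yes b≡a | _       = ⊥-elim (a≢b (sym b≡a))
  ... | no _    | yes _   = refl
  ... | no _    | no b≢b = ⊥-elim (b≢b refl)

  patch-other : ∀ a b f v → v ≢ a → v ≢ b → patch a b f v ≡ f v
  patch-other a b f v v≢a v≢b with v ≟ a | v ≟ b
  ... | yes v≡a | _       = ⊥-elim (v≢a v≡a)
  ... | no _    | yes v≡b = ⊥-elim (v≢b v≡b)
  ... | no _    | no _    = refl

  -- The three hypotheses relating S and T′ say that T′ is the disjoint union of S and {a, b}.
  PerfectMatchingOn-patch : ∀ {S T′ : Fin n → Set} {f a b} → Adj a b → PerfectMatchingOn Adj S f →
    (∀ {v} → S v → v ≢ a × v ≢ b) → (∀ {v} → S v → T′ v) →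
    (∀ {v} → T′ v → v ≢ a → v ≢ b → S v) → T′ a → T′ b → PerfectMatchingOn Adj T′ (patch a b f)
  PerfectMatchingOn-patch {f = f} {a} {b} ab pm S⇒≢ S⇒T T⇒S Ta Tb v Tv with v ≟ a
  ... | yes refl = Tb , ab , patch-second a b f (adj⇒≢ G ab)
  ... | no v≢a with v ≟ b
  ... | yes refl = Ta , Adj-sym ab , patch-first a b f
  ... | no v≢b =
    let Sfv , afv , ffv = pm v (T⇒S Tv v≢a v≢b)
        fv≢a , fv≢b = S⇒≢ Sfv
    in S⇒T Sfv , afv , trans (patch-other a b f _ fv≢a fv≢b) ffv

  ThreeConnected⇒Connected : ThreeConnected G → Connected Adj
  ThreeConnected⇒Connected (_ , conn) x y _ _ = Walk-weaken (λ _ _ r → r) (conn [] z≤n x y (λ ()) (λ ()))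

  Brick⇒MatchingCovered : Brick G → MatchingCovered Adj
  Brick⇒MatchingCovered (3conn , bicritical) = ThreeConnected⇒Connected 3conn , covered
    where
      covered : ∀ x y → Adj x y → Σ (Fin n → Fin n) λ m → PerfectMatching Adj m × m x ≡ y
      covered x y xy =
        let N , pmN = bicritical x y (adj⇒≢ G xy)
        in patch x y N , PerfectMatchingOn-patch xy pmN id (λ _ → tt) (λ _ v≢x v≢y → v≢x , v≢y) tt tt ,
           patch-first x y N

  ThreeConnected⇒Walk-DeleteEdge : ThreeConnected G → ∀ {a b x y} → x ≢ a → y ≢ a →
    Walk (DeleteEdge Adj a b) (λ _ → ⊤) x y
  ThreeConnected⇒Walk-DeleteEdge (_ , conn) {a} {b} {x} {y} x≢a y≢a =
    Walk-weaken (λ u∉ v∉ r → r , (λ (u≡a , _) → u∉ (here u≡a)) , λ (_ , v≡a) → v∉ (here v≡a))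
      (conn (a ∷ []) (s≤s z≤n) x y (λ { (here x≡a) → x≢a x≡a }) (λ { (here y≡a) → y≢a y≡a }))

  ThreeConnected⇒Connected-DeleteEdge : ThreeConnected G → ∀ {a b c} → Adj a c → c ≢ b →
    Connected (DeleteEdge Adj a b)
  ThreeConnected⇒Connected-DeleteEdge 3conn {a} {b} {c} ac c≢b x y _ _ with x ≟ a | y ≟ a
  ... | yes refl | yes refl = stop tt
  ... | yes refl | no y≢a   =
    step tt (ac , (λ (_ , c≡b) → c≢b c≡b) , λ (_ , c≡a) → c≢a c≡a)
      (ThreeConnected⇒Walk-DeleteEdge 3conn c≢a y≢a)
    where
      c≢a : c ≢ a
      c≢a c≡a = adj⇒≢ G ac (sym c≡a)
  ... | no x≢a   | yes refl =
    Walk-snoc (ThreeConnected⇒Walk-DeleteEdge 3conn x≢a c≢a)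
      (Adj-sym ac , (λ (c≡a , _) → c≢a c≡a) , λ (c≡b , _) → c≢b c≡b)
    where
      c≢a : c ≢ a
      c≢a c≡a = adj⇒≢ G ac (sym c≡a)
  ... | no x≢a   | no y≢a   = ThreeConnected⇒Walk-DeleteEdge 3conn x≢a y≢a

module CubicTriangle {n : ℕ} (G : SimpleGraph n) (cubic : Cubic G) (u₁ u₂ u₃ v₁ : Fin n)
  (tri : Triangle G u₁ u₂ u₃) (u₁v₁ : SimpleGraph.Adj G u₁ v₁) (v₁≢u₂ : v₁ ≢ u₂) (v₁≢u₃ : v₁ ≢ u₃)
  where
  open SimpleGraph G
  open Contraction G u₁ u₂ u₃

  degree₃ : ∀ v → countTrue (adj v) ≡ 3
  degree₃ v = trans (sym (degree≡countTrue G v)) (cubic v)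

  u₁u₂ : Adj u₁ u₂
  u₁u₂ = proj₁ tri
  u₂u₃ : Adj u₂ u₃
  u₂u₃ = proj₁ (proj₂ tri)
  u₁u₃ : Adj u₁ u₃
  u₁u₃ = proj₂ (proj₂ tri)

  u₁≢u₂ : u₁ ≢ u₂
  u₁≢u₂ = adj⇒≢ G u₁u₂
  u₂≢u₃ : u₂ ≢ u₃
  u₂≢u₃ = adj⇒≢ G u₂u₃
  u₁≢u₃ : u₁ ≢ u₃
  u₁≢u₃ = adj⇒≢ G u₁u₃

  private
    third-of-u₂ : ∃[ w ] Adj u₂ w × w ≢ u₁ × w ≢ u₃
    third-of-u₂ = third-true (adj u₂) (degree₃ u₂) (Adj-sym G u₁u₂) u₂u₃ u₁≢u₃
    third-of-u₃ : ∃[ w ] Adj u₃ w × w ≢ u₁ × w ≢ u₂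
    third-of-u₃ = third-true (adj u₃) (degree₃ u₃) (Adj-sym G u₁u₃) (Adj-sym G u₂u₃) u₁≢u₂

  w₂ : Fin n
  w₂ = proj₁ third-of-u₂
  u₂w₂ : Adj u₂ w₂
  u₂w₂ = proj₁ (proj₂ third-of-u₂)
  w₃ : Fin n
  w₃ = proj₁ third-of-u₃
  u₃w₃ : Adj u₃ w₃
  u₃w₃ = proj₁ (proj₂ third-of-u₃)

  w₂≢u₁ : w₂ ≢ u₁
  w₂≢u₁ = proj₁ (proj₂ (proj₂ third-of-u₂))
  w₂≢u₃ : w₂ ≢ u₃
  w₂≢u₃ = proj₂ (proj₂ (proj₂ third-of-u₂))
  w₃≢u₁ : w₃ ≢ u₁
  w₃≢u₁ = proj₁ (proj₂ (proj₂ third-of-u₃))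
  w₃≢u₂ : w₃ ≢ u₂
  w₃≢u₂ = proj₂ (proj₂ (proj₂ third-of-u₃))

  neighbour-u₁ : ∀ {y} → Adj u₁ y → y ≡ u₂ ⊎ y ≡ u₃ ⊎ y ≡ v₁
  neighbour-u₁ =
    only-three-true (adj u₁) (degree₃ u₁) u₁u₂ u₁u₃ u₁v₁ u₂≢u₃ (v₁≢u₂ ∘ sym) (v₁≢u₃ ∘ sym)

  neighbour-u₂ : ∀ {y} → Adj u₂ y → y ≡ u₁ ⊎ y ≡ u₃ ⊎ y ≡ w₂
  neighbour-u₂ = only-three-true (adj u₂) (degree₃ u₂) (Adj-sym G u₁u₂) u₂u₃ u₂w₂ u₁≢u₃
    (w₂≢u₁ ∘ sym) (w₂≢u₃ ∘ sym)

  neighbour-u₃ : ∀ {y} → Adj u₃ y → y ≡ u₁ ⊎ y ≡ u₂ ⊎ y ≡ w₃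
  neighbour-u₃ = only-three-true (adj u₃) (degree₃ u₃) (Adj-sym G u₁u₃) (Adj-sym G u₂u₃) u₃w₃ u₁≢u₂
    (w₃≢u₁ ∘ sym) (w₃≢u₂ ∘ sym)

  outside⇒∉X : ∀ {v} → T (outside v) → ¬ InX v
  outside⇒∉X {v} o v∈X with v ≟ u₁ | v ≟ u₂ | v ≟ u₃
  outside⇒∉X o (inj₁ v≡u₁)        | no v≢u₁ | _       | _       = v≢u₁ v≡u₁
  outside⇒∉X o (inj₂ (inj₁ v≡u₂)) | no _    | no v≢u₂ | _       = v≢u₂ v≡u₂
  outside⇒∉X o (inj₂ (inj₂ v≡u₃)) | no _    | no _    | no v≢u₃ = v≢u₃ v≡u₃

  just-cong : ∀ {y y′} {o : T (outside y)} {o′ : T (outside y′)} → y ≡ y′ →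
    _≡_ {A = CV} (just (y , o)) (just (y′ , o′))
  just-cong {o = o} {o′} refl = cong (λ o″ → just (_ , o″)) (T-irrelevant o o′)

  -- In a lift, a is the triangle vertex matched out of the triangle and b is matched with u₁.
  data Ordering₂₃ : Fin n → Fin n → Set where
    u₂-first : Ordering₂₃ u₂ u₃
    u₃-first : Ordering₂₃ u₃ u₂

  Ordering₂₃⇒InX : ∀ {a b} → Ordering₂₃ a b → InX a × InX b
  Ordering₂₃⇒InX u₂-first = inj₂ (inj₁ refl) , inj₂ (inj₂ refl)
  Ordering₂₃⇒InX u₃-first = inj₂ (inj₂ refl) , inj₂ (inj₁ refl)

  Ordering₂₃⇒distinct : ∀ {a b} → Ordering₂₃ a b → a ≢ u₁ × a ≢ b
  Ordering₂₃⇒distinct u₂-first = u₁≢u₂ ∘ sym , u₂≢u₃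
  Ordering₂₃⇒distinct u₃-first = u₁≢u₃ ∘ sym , u₂≢u₃ ∘ sym

  Ordering₂₃⇒Adj-u₁ : ∀ {a b} → Ordering₂₃ a b → Adj u₁ b
  Ordering₂₃⇒Adj-u₁ u₂-first = u₁u₃
  Ordering₂₃⇒Adj-u₁ u₃-first = u₁u₂

  Ordering₂₃⇒outside : ∀ {a b v} → Ordering₂₃ a b → v ≢ u₁ → v ≢ a → v ≢ b → T (outside v)
  Ordering₂₃⇒outside u₂-first v≢u₁ v≢a v≢b = outside-intro _ v≢u₁ v≢a v≢b
  Ordering₂₃⇒outside u₃-first v≢u₁ v≢a v≢b = outside-intro _ v≢u₁ v≢b v≢a

  Ordering₂₃⇒avoids : ∀ {a b m y₀} → Ordering₂₃ a b → PerfectMatching Adj m → T (outside y₀) →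
    m a ≡ y₀ → m u₁ ≡ b → m u₂ ≢ u₃
  Ordering₂₃⇒avoids u₂-first pm o₀ mu₂≡y₀ _ mu₂≡u₃ =
    outside⇒∉X o₀ (inj₂ (inj₂ (trans (sym mu₂≡y₀) mu₂≡u₃)))
  Ordering₂₃⇒avoids u₃-first pm o₀ _ mu₁≡u₂ mu₂≡u₃ =
    u₁≢u₃ (trans (sym (PerfectMatching-sym {R = Adj} pm mu₁≡u₂)) mu₂≡u₃)

  module Lift {M : CV → CV} (pm : PerfectMatching CAdj M) {a b y₀ : Fin n} {o₀ : T (outside y₀)}
    (M-u : M nothing ≡ just (y₀ , o₀)) (ay₀ : Adj a y₀) (ord : Ordering₂₃ a b) where

    -- reads the contracted vertex u as a, the triangle vertex joined to y₀
    lower : CV → Fin n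
    lower nothing         = a
    lower (just (w , _)) = w

    restricted : Fin n → Fin n
    restricted v with T? (outside v)
    ... | yes o = lower (M (just (v , o)))
    ... | no _  = v

    restricted-outside : ∀ {v} (o : T (outside v)) → restricted v ≡ lower (M (just (v , o)))
    restricted-outside {v} o with T? (outside v)
    ... | yes o′ = cong (λ o″ → lower (M (just (v , o″)))) (T-irrelevant o′ o)
    ... | no ¬o  = ⊥-elim (¬o o)

    M-inv : ∀ v → M (M v) ≡ v
    M-inv = PerfectMatching-involutive {R = CAdj} pm

    M-≢u : ∀ {v} {o : T (outside v)} → v ≢ y₀ → M (just (v , o)) ≢ nothing
    M-≢u {v} {o} v≢y₀ Mv≡u = v≢y₀ (cong lower (trans (sym (trans (cong M (sym Mv≡u)) (M-inv _))) M-u))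

    M-y₀ : ∀ {o} → M (just (y₀ , o)) ≡ nothing
    M-y₀ = trans (cong M (sym (trans M-u (just-cong refl)))) (M-inv nothing)

    Outside∖y₀ : Fin n → Set
    Outside∖y₀ v = T (outside v) × v ≢ y₀

    restricted-perfect : PerfectMatchingOn Adj Outside∖y₀ restricted
    restricted-perfect v (o , v≢y₀) rewrite restricted-outside {v} o
      with M (just (v , o)) in Mv | pm (just (v , o)) tt
    ... | nothing       | _ = ⊥-elim (M-≢u v≢y₀ Mv)
    ... | just (w , ow) | (_ , vw , Mw) = (ow , w≢y₀) , vw , trans (restricted-outside ow) (cong lower Mw)
      where
        w≢y₀ : w ≢ y₀
        w≢y₀ refl with () ← trans (sym (trans (cong M (sym Mv)) (M-inv _))) M-y₀

    private
      a∈X : InX a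
      a∈X = proj₁ (Ordering₂₃⇒InX ord)
      b∈X : InX b
      b∈X = proj₂ (Ordering₂₃⇒InX ord)
      a≢u₁ : a ≢ u₁
      a≢u₁ = proj₁ (Ordering₂₃⇒distinct ord)
      a≢b : a ≢ b
      a≢b = proj₂ (Ordering₂₃⇒distinct ord)
      u₁b : Adj u₁ b
      u₁b = Ordering₂₃⇒Adj-u₁ ord

      outside-≢a : ∀ {v} → T (outside v) → v ≢ a
      outside-≢a o refl = outside⇒∉X o a∈X
      outside-≢b : ∀ {v} → T (outside v) → v ≢ b
      outside-≢b o refl = outside⇒∉X o b∈X
      outside-≢u₁ : ∀ {v} → T (outside v) → v ≢ u₁
      outside-≢u₁ o = outside⇒∉X o ∘ inj₁

    extended : Fin n → Fin n
    extended = patch G a y₀ restricted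

    extended-perfect : PerfectMatchingOn Adj (λ v → v ≢ u₁ × v ≢ b) extended
    extended-perfect = PerfectMatchingOn-patch G ay₀ restricted-perfect
      (λ (o , v≢y₀) → outside-≢a o , v≢y₀)
      (λ (o , _) → outside-≢u₁ o , outside-≢b o)
      (λ (v≢u₁ , v≢b) v≢a v≢y₀ → Ordering₂₃⇒outside ord v≢u₁ v≢a v≢b , v≢y₀)
      (a≢u₁ , a≢b) (outside-≢u₁ o₀ , outside-≢b o₀)

    lifted : Fin n → Fin n
    lifted = patch G u₁ b extended

    lifted-perfect : PerfectMatching Adj lifted
    lifted-perfect = PerfectMatchingOn-patch G u₁b extended-perfect id (λ _ → tt) (λ _ → _,_) tt tt

    lifted-avoids : lifted u₂ ≢ u₃
    lifted-avoids = Ordering₂₃⇒avoids ord lifted-perfect o₀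
      (trans (patch-other G u₁ b extended a a≢u₁ a≢b) (patch-first G a y₀ restricted))
      (patch-first G u₁ b extended)

    lifted-extends : ∀ {x y} {ox : T (outside x)} {oy : T (outside y)} →
      M (just (x , ox)) ≡ just (y , oy) → lifted x ≡ y
    lifted-extends {x} {y} {ox} Mx = begin
      lifted x                   ≡⟨ patch-other G u₁ b extended x (outside-≢u₁ ox) (outside-≢b ox) ⟩
      extended x                 ≡⟨ patch-other G a y₀ restricted x (outside-≢a ox) x≢y₀ ⟩
      restricted x               ≡⟨ restricted-outside ox ⟩
      lower (M (just (x , ox)))  ≡⟨ cong lower Mx ⟩
      y                          ∎
      where
        open ≡-Reasoning
        x≢y₀ : x ≢ y₀
        x≢y₀ refl with () ← trans (sym Mx) M-y₀

  w₂-outside : T (outside w₂)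
  w₂-outside = outside-intro w₂ w₂≢u₁ (adj⇒≢ G u₂w₂ ∘ sym) w₂≢u₃

  v₁′ : CV
  v₁′ = old v₁ (λ q → adj⇒≢ G u₁v₁ (sym q)) v₁≢u₂ v₁≢u₃

  H : CV → CV → Set
  H = DeleteEdge CAdj nothing v₁′

  H-edge : ∀ {x y} {ox : T (outside x)} {oy : T (outside y)} → Adj x y → H (just (x , ox)) (just (y , oy))
  H-edge xy = xy , (λ { (() , _) }) , λ { (_ , ()) }

  -- the possible partners of u in a perfect matching of H
  Candidate : Fin n → Set
  Candidate y = y ≢ v₁ × (y ≡ w₂ ⊎ y ≡ w₃)

  outside-neighbour-u₁ : ∀ {y} → T (outside y) → Adj u₁ y → y ≡ v₁
  outside-neighbour-u₁ oy u₁y with neighbour-u₁ u₁y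
  ... | inj₁ y≡u₂        = ⊥-elim (outside⇒∉X oy (inj₂ (inj₁ y≡u₂)))
  ... | inj₂ (inj₁ y≡u₃) = ⊥-elim (outside⇒∉X oy (inj₂ (inj₂ y≡u₃)))
  ... | inj₂ (inj₂ y≡v₁) = y≡v₁

  neighbour-u₁-off-triangle : ∀ {y} → Adj u₁ y → y ≢ u₂ → y ≢ u₃ → y ≡ v₁
  neighbour-u₁-off-triangle u₁y y≢u₂ y≢u₃ =
    outside-neighbour-u₁ (outside-intro _ (adj⇒≢ G u₁y ∘ sym) y≢u₂ y≢u₃) u₁y

  outside-neighbour-of-X : ∀ {x y} → InX x → Adj x y → T (outside y) → y ≢ v₁ → y ≡ w₂ ⊎ y ≡ w₃
  outside-neighbour-of-X (inj₁ refl) xy oy y≢v₁ = ⊥-elim (y≢v₁ (outside-neighbour-u₁ oy xy))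
  outside-neighbour-of-X (inj₂ (inj₁ refl)) xy oy y≢v₁ with neighbour-u₂ xy
  ... | inj₁ y≡u₁        = ⊥-elim (outside⇒∉X oy (inj₁ y≡u₁))
  ... | inj₂ (inj₁ y≡u₃) = ⊥-elim (outside⇒∉X oy (inj₂ (inj₂ y≡u₃)))
  ... | inj₂ (inj₂ y≡w₂) = inj₁ y≡w₂
  outside-neighbour-of-X (inj₂ (inj₂ refl)) xy oy y≢v₁ with neighbour-u₃ xy
  ... | inj₁ y≡u₁        = ⊥-elim (outside⇒∉X oy (inj₁ y≡u₁))
  ... | inj₂ (inj₁ y≡u₂) = ⊥-elim (outside⇒∉X oy (inj₂ (inj₁ y≡u₂)))
  ... | inj₂ (inj₂ y≡w₃) = inj₂ y≡w₃

  record Partner (M : CV → CV) : Set where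
    field
      partner           : Fin n
      partner-outside   : T (outside partner)
      M-u               : M nothing ≡ just (partner , partner-outside)
      partner-candidate : Candidate partner

  u-partner : ∀ {M} → PerfectMatching H M → Partner M
  u-partner {M} pm with M nothing in Mu | pm nothing tt
  ... | just (y , oy) | _ , ((x , x∈X , xy) , ¬uv₁ , _) , _ = record
    { partner = y ; partner-outside = oy ; M-u = Mu
    ; partner-candidate = y≢v₁ , outside-neighbour-of-X x∈X xy oy y≢v₁ }
    where
      y≢v₁ : y ≢ v₁
      y≢v₁ y≡v₁ = ¬uv₁ (refl , just-cong y≡v₁)

  candidate-ordering : ∀ {y} → y ≡ w₂ ⊎ y ≡ w₃ → ∃[ a ] ∃[ b ] Ordering₂₃ a b × Adj a y
  candidate-ordering (inj₁ refl) = u₂ , u₃ , u₂-first , u₂w₂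
  candidate-ordering (inj₂ refl) = u₃ , u₂ , u₃-first , u₃w₃

  candidate-unique : w₂ ≡ w₃ → ∀ {y} → y ≡ w₂ ⊎ y ≡ w₃ → y ≡ w₂
  candidate-unique w₂≡w₃ (inj₁ y≡w₂) = y≡w₂
  candidate-unique w₂≡w₃ (inj₂ y≡w₃) = trans y≡w₃ (sym w₂≡w₃)

  w₂-outside-neighbour : w₂ ≡ w₃ → w₂ ≢ v₁ → ∃[ z ] T (outside z) × Adj w₂ z
  w₂-outside-neighbour w₂≡w₃ w₂≢v₁ with third-true (adj w₂) (degree₃ w₂) (Adj-sym G u₂w₂)
                                           (Adj-sym G (subst (Adj u₃) (sym w₂≡w₃) u₃w₃)) u₂≢u₃
  ... | z , w₂z , z≢u₂ , z≢u₃ = z , outside-intro z z≢u₁ z≢u₂ z≢u₃ , w₂z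
    where
      z≢u₁ : z ≢ u₁
      z≢u₁ refl = w₂≢v₁ (outside-neighbour-u₁ w₂-outside (Adj-sym G w₂z))

  u-partner-unmatched : ∀ {M} (pm : PerfectMatching H M) {t ot z oz} → t ≡ Partner.partner (u-partner pm) →
    M (just (t , ot)) ≢ just (z , oz)
  u-partner-unmatched {M} pm t≡p Mt≡z
    with () ← trans (sym Mt≡z) (trans (cong M (sym (trans (Partner.M-u (u-partner pm)) (just-cong (sym t≡p)))))
                                      (PerfectMatching-involutive {R = H} pm nothing))

  Avoiding : Fin n → Fin n → Set
  Avoiding x y = ∃[ m ] PerfectMatching Adj m × m u₂ ≢ u₃ × m x ≡ y

  Avoiding-sym : ∀ {x y} → Avoiding x y → Avoiding y x
  Avoiding-sym (m , pm , avoids , mx≡y) = m , pm , avoids , PerfectMatching-sym {R = Adj} pm mx≡y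

  module Rematch {N : Fin n → Fin n} (pmN : PerfectMatchingOn Adj (λ v → v ≢ w₂ × v ≢ w₃) N)
    (w₂≢w₃ : w₂ ≢ w₃) where

    private
      S-u₁ : u₁ ≢ w₂ × u₁ ≢ w₃
      S-u₁ = w₂≢u₁ ∘ sym , w₃≢u₁ ∘ sym
      S-u₂ : u₂ ≢ w₂ × u₂ ≢ w₃
      S-u₂ = adj⇒≢ G u₂w₂ , w₃≢u₂ ∘ sym
      S-u₃ : u₃ ≢ w₂ × u₃ ≢ w₃
      S-u₃ = w₂≢u₃ ∘ sym , adj⇒≢ G u₃w₃

      N-adj : ∀ {v} → v ≢ w₂ × v ≢ w₃ → Adj v (N v)
      N-adj Sv = proj₁ (proj₂ (pmN _ Sv))

      u₂-neighbours : ∀ {y} → Adj u₂ y → y ≢ w₂ × y ≢ w₃ → y ≡ u₁ ⊎ y ≡ u₃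
      u₂-neighbours u₂y (y≢w₂ , _) with neighbour-u₂ u₂y
      ... | inj₁ y≡u₁        = inj₁ y≡u₁
      ... | inj₂ (inj₁ y≡u₃) = inj₂ y≡u₃
      ... | inj₂ (inj₂ y≡w₂) = ⊥-elim (y≢w₂ y≡w₂)

      u₃-neighbours : ∀ {y} → Adj u₃ y → y ≢ w₂ × y ≢ w₃ → y ≡ u₁ ⊎ y ≡ u₂
      u₃-neighbours u₃y (_ , y≢w₃) with neighbour-u₃ u₃y
      ... | inj₁ y≡u₁        = inj₁ y≡u₁
      ... | inj₂ (inj₁ y≡u₂) = inj₂ y≡u₂
      ... | inj₂ (inj₂ y≡w₃) = ⊥-elim (y≢w₃ y≡w₃)

    -- matching u₁ inside the triangle would leave its third vertex without an available neighbour
    N-u₁ : N u₁ ≡ v₁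
    N-u₁ with neighbour-u₁ (N-adj S-u₁)
    ... | inj₁ Nu₁≡u₂ =
      ⊥-elim (PerfectMatchingOn-stranded {R = Adj} pmN S-u₃ S-u₁ Nu₁≡u₂ (u₁≢u₃ ∘ sym) (u₂≢u₃ ∘ sym)
                u₃-neighbours)
    ... | inj₂ (inj₁ Nu₁≡u₃) =
      ⊥-elim (PerfectMatchingOn-stranded {R = Adj} pmN S-u₂ S-u₁ Nu₁≡u₃ (u₁≢u₂ ∘ sym) u₂≢u₃ u₂-neighbours)
    ... | inj₂ (inj₂ Nu₁≡v₁) = Nu₁≡v₁

    N-u₂ : N u₂ ≡ u₃
    N-u₂ with u₂-neighbours (N-adj S-u₂) (proj₁ (pmN u₂ S-u₂))
    ... | inj₁ Nu₂≡u₁ =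
      ⊥-elim (v₁≢u₂ (trans (sym N-u₁)
                          (trans (cong N (sym Nu₂≡u₁)) (PerfectMatchingOn-involutive {R = Adj} pmN S-u₂))))
    ... | inj₂ Nu₂≡u₃ = Nu₂≡u₃

    rematched : Fin n → Fin n
    rematched = patch G u₂ w₂ (patch G u₃ w₃ N)

    rematched-perfect : PerfectMatching Adj rematched
    rematched-perfect =
      PerfectMatchingOn-patch G u₂w₂
        (PerfectMatchingOn-patch G u₃w₃ (PerfectMatchingOn-removePair {R = Adj} pmN S-u₂ N-u₂)
          (λ ((_ , v≢w₃) , _ , v≢u₃) → v≢u₃ , v≢w₃)
          (λ ((v≢w₂ , _) , v≢u₂ , _) → v≢w₂ , v≢u₂)
          (λ (v≢w₂ , v≢u₂) v≢u₃ v≢w₃ → (v≢w₂ , v≢w₃) , v≢u₂ , v≢u₃)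
          (proj₁ S-u₃ , u₂≢u₃ ∘ sym) (w₂≢w₃ ∘ sym , w₃≢u₂))
        (λ (v≢w₂ , v≢u₂) → v≢u₂ , v≢w₂) (λ _ → tt) (λ _ v≢u₂ v≢w₂ → v≢w₂ , v≢u₂) tt tt

    rematched-u₁ : rematched u₁ ≡ v₁
    rematched-u₁ = begin
      rematched u₁             ≡⟨ patch-other G u₂ w₂ (patch G u₃ w₃ N) u₁ u₁≢u₂ (proj₁ S-u₁) ⟩
      patch G u₃ w₃ N u₁       ≡⟨ patch-other G u₃ w₃ N u₁ u₁≢u₃ (proj₂ S-u₁) ⟩
      N u₁                     ≡⟨ N-u₁ ⟩
      v₁                       ∎
      where open ≡-Reasoning

    rematched-avoids : rematched u₂ ≢ u₃
    rematched-avoids = w₂≢u₃ ∘ trans (sym (patch-first G u₂ w₂ (patch G u₃ w₃ N)))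

  u₁v₁-avoiding : Brick G → w₂ ≢ w₃ → Avoiding u₁ v₁
  u₁v₁-avoiding (_ , bicritical) w₂≢w₃ =
    let N , pmN = bicritical w₂ w₃ w₂≢w₃
        open Rematch pmN w₂≢w₃
    in rematched , rematched-perfect , rematched-avoids , rematched-u₁

  module _ (H-covered : MatchingCovered H) where

    outside-edge-avoiding : ∀ {x y} → T (outside x) → T (outside y) → Adj x y → Avoiding x y
    outside-edge-avoiding ox oy xy with proj₂ H-covered (just (_ , ox)) (just (_ , oy)) (H-edge xy)
    ... | M , pm , Mx≡y =
      let open Partner (u-partner pm)
          _ , _ , ord , ay₀ = candidate-ordering (proj₂ partner-candidate)
          open Lift (PerfectMatching-⊆ {R = H} pm proj₁) M-u ay₀ ord
      in lifted , lifted-perfect , lifted-avoids , lifted-extends Mx≡y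

    candidate-exists : ∃[ y ] Candidate y
    candidate-exists =
      let M , pm = MatchingCovered⇒PerfectMatching {x = nothing} {y = v₁′} H-covered (λ ())
          open Partner (u-partner pm)
      in partner , partner-candidate

    -- If w₂ = w₃, every perfect matching of H matches u with w₂, so no other edge at w₂ is in one.
    w₂≢w₃ : w₂ ≢ w₃
    w₂≢w₃ w₂≡w₃ =
      let y , y≢v₁ , y∈ = candidate-exists
          w₂≢v₁ = λ w₂≡v₁ → y≢v₁ (trans (candidate-unique w₂≡w₃ y∈) w₂≡v₁)
          z , oz , w₂z = w₂-outside-neighbour w₂≡w₃ w₂≢v₁
          M , pm , Mw₂≡z = proj₂ H-covered (just (w₂ , w₂-outside)) (just (z , oz)) (H-edge w₂z)
          open Partner (u-partner pm)
      in u-partner-unmatched pm (sym (candidate-unique w₂≡w₃ (proj₂ partner-candidate))) Mw₂≡z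

    off-u₂u₃-avoiding : Brick G → ∀ {x y} → x ≢ u₂ → x ≢ u₃ → y ≢ u₂ → y ≢ u₃ → Adj x y → Avoiding x y
    off-u₂u₃-avoiding brick {x} {y} x≢u₂ x≢u₃ y≢u₂ y≢u₃ xy with x ≟ u₁ | y ≟ u₁
    ... | yes refl | _ =
      subst (Avoiding u₁) (sym (neighbour-u₁-off-triangle xy y≢u₂ y≢u₃)) (u₁v₁-avoiding brick w₂≢w₃)
    ... | no _ | yes refl = Avoiding-sym
      (subst (Avoiding u₁) (sym (neighbour-u₁-off-triangle (Adj-sym G xy) x≢u₂ x≢u₃)) (u₁v₁-avoiding brick w₂≢w₃))
    ... | no x≢u₁ | no y≢u₁ =
      outside-edge-avoiding (outside-intro x x≢u₁ x≢u₂ x≢u₃) (outside-intro y y≢u₁ y≢u₂ y≢u₃) xy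

    DeleteEdge-avoiding : Brick G → ∀ {x y} → DeleteEdge Adj u₂ u₃ x y → Avoiding x y
    DeleteEdge-avoiding brick {x} {y} d@(xy , _) with x ≟ u₂ ⊎-dec x ≟ u₃ ⊎-dec y ≟ u₂ ⊎-dec y ≟ u₃
    ... | yes touches =
      let m , pm , mx≡y = proj₂ (Brick⇒MatchingCovered G brick) x y xy
      in m , pm , PerfectMatching-avoids-adjacent {R = Adj} pm mx≡y d touches , mx≡y
    ... | no ¬touches = off-u₂u₃-avoiding brick (¬touches ∘ inj₁) (¬touches ∘ inj₂ ∘ inj₁)
      (¬touches ∘ inj₂ ∘ inj₂ ∘ inj₁) (¬touches ∘ inj₂ ∘ inj₂ ∘ inj₂) xy

corollary2p9 : ∀ {n : ℕ} (G : SimpleGraph n) → Cubic G → Brick G →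
    (u₁ u₂ u₃ v₁ : Fin n) → Triangle G u₁ u₂ u₃ →
    (e : SimpleGraph.Adj G u₁ v₁) → (p₂ : v₁ ≢ u₂) → (p₃ : v₁ ≢ u₃) →
    Removable (Contraction.CAdj G u₁ u₂ u₃) nothing
      (Contraction.old G u₁ u₂ u₃ v₁ (λ q → adj⇒≢ G e (sym q)) p₂ p₃) →
    Removable (SimpleGraph.Adj G) u₂ u₃
corollary2p9 G cubic brick u₁ u₂ u₃ v₁ tri e p₂ p₃ (_ , _ , H-covered) =
  Brick⇒MatchingCovered G brick , u₂u₃ ,
  ThreeConnected⇒Connected-DeleteEdge G (proj₁ brick) (Adj-sym G u₁u₂) u₁≢u₃ ,
  λ x y d → let m , pm , avoids , mx≡y = DeleteEdge-avoiding H-covered brick d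
            in m , PerfectMatching-DeleteEdge {R = SimpleGraph.Adj G} pm avoids , mx≡y
  where open CubicTriangle G cubic u₁ u₂ u₃ v₁ tri e p₂ p₃
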